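{- Let $G$ be a connected triangle-free graph of order $n$, size $m$ (number of edges), minimum degree $\delta\geq 2$ and vertex-connectivity $\kappa$. If $$m \geq \delta^2+\left\lfloor\tfrac14 (n-\delta)^2\right\rfloor,$$ then $G$ is super-$\kappa$.
   Context: All graphs are finite, simple and undirected. A vertex-cut of a connected graph is a set of vertices whose removal disconnects it; a minimum vertex-cut is one of minimum size. $G$ is super-connected (super-$\kappa$) if every minimum vertex-cut isolates a vertex of minimum degree (i.e., for every minimum vertex-cut $S$, some component of $G-S$ is a single vertex of degree $\delta(G)$). -}

module Defs where

open import Data.Nat using (ℕ; _≤_; _<ᵇ_; _+_)
open import Data.Bool using (Bool; true; false; _∧_)
open import Data.Fin using (Fin; toℕ)
open import Data.Fin.Subset using (Subset; _∈_; _∉_; ∣_∣)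
open import Data.Vec using (tabulate)
open import Data.List using (map; allFin)
open import Data.Nat.ListAction using (sum)
open import Data.Empty using (⊥)
open import Data.Product using (Σ; _×_; ∃; _,_)
open import Relation.Nullary using (¬_)
open import Relation.Binary.PropositionalEquality using (_≡_)

record Graph (n : ℕ) : Set where
  field
    adj   : Fin n → Fin n → Bool
    sym   : ∀ u v → adj u v ≡ adj v u
    irrfl : ∀ u → adj u u ≡ false

open Graph public

module _ {n : ℕ} (G : Graph n) where

  Adj : Fin n → Fin n → Set
  Adj u v = adj G u v ≡ true

  degree : Fin n → ℕ
  degree u = ∣ tabulate (adj G u) ∣

  size : ℕ
  size = sum (map (λ u → ∣ tabulate (λ v → (toℕ u <ᵇ toℕ v) ∧ adj G u v) ∣) (allFin n))

  IsMinDegree : ℕ → Set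
  IsMinDegree δ = (∀ v → δ ≤ degree v) × ∃ (λ v → degree v ≡ δ)

  TriangleFree : Set
  TriangleFree = ∀ u v w → Adj u v → Adj v w → Adj u w → ⊥

  data Reach (S : Subset n) : Fin n → Fin n → Set where
    here : ∀ {u} → u ∉ S → Reach S u u
    step : ∀ {u v w} → u ∉ S → Adj u v → Reach S v w → Reach S u w

  Connected : Set
  Connected = ∀ u v → Reach (tabulate (λ _ → false)) u v

  IsVertexCut : Subset n → Set
  IsVertexCut S = Σ (Fin n) λ u → Σ (Fin n) λ v → u ∉ S × v ∉ S × ¬ Reach S u v

  IsMinVertexCut : Subset n → Set
  IsMinVertexCut S = IsVertexCut S × (∀ T → IsVertexCut T → ∣ S ∣ ≤ ∣ T ∣)

  -- super-κ: every minimum vertex-cut S leaves an isolated vertex of G - S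
  -- (a singleton component) whose degree is δ(G)
  SuperConnected : ℕ → Set
  SuperConnected δ = ∀ S → IsMinVertexCut S →
    Σ (Fin n) λ v → v ∉ S × (∀ w → Adj v w → w ∈ S) × degree v ≡ δ

module Submission where

-- Let S be a minimum vertex cut.  In a triangle-free graph with δ ≥ 2 the
-- neighbourhood of a vertex of degree δ is a vertex cut, so |S| ≤ δ, and a
-- vertex isolated by S therefore has degree exactly δ.  Suppose G − S has no
-- isolated vertex; let X be the component of G − S containing one side of the
-- cut and Y the rest.  Adjacent vertices have disjoint neighbourhoods, so
-- |X ∪ S| and |Y ∪ S| are at least 2δ.  Every edge lies inside X ∪ S or inside
-- Y ∪ S, so Mantel's theorem gives 4m ≤ |X ∪ S|² + |Y ∪ S|²; counting the edges
-- that meet X (resp. Y) gives a sharper bound for each side.  Against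
-- m ≥ δ² + ⌊(n − δ)²/4⌋ these force |S| = δ and |X| = δ or |Y| = δ, and then
-- the bound for that side fails.

open import Defs hiding (sym)
open import Data.Nat using (ℕ; _≤_; _+_; _*_; _∸_; _/_)

open import Data.Bool as Bool using (Bool; true; false; _∧_; _∨_; not; T)
open import Data.Bool.Properties
  using ( T-≡; ∧-conicalˡ; ∧-conicalʳ; ∨-conicalˡ; ∨-conicalʳ; ∨-zeroʳ; ∨-inverseˡ; ∨-inverseʳ
        ; not-involutive; ¬-not)
open import Data.Empty using (⊥; ⊥-elim)
open import Data.Fin using (Fin; zero; suc; toℕ; _≟_)
open import Data.Fin.Properties using (toℕ-injective; any?; all?; ¬∀⟶∃¬)
open import Data.Fin.Subset using (Subset; _∈_; _∉_; ∣_∣; ⁅_⁆)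
open import Data.Fin.Subset.Properties using (x∈⁅x⁆; ∣⁅x⁆∣≡1; _∈?_)
import Data.List as List
import Data.List.Extrema as Extrema
open import Data.List.Membership.Propositional.Properties using (∈-allFin)
open import Data.List.Properties using (map-tabulate)
import Data.List.Relation.Unary.All as All
open import Data.Nat using (zero; suc; _<_; _%_; _<ᵇ_; z≤n; s≤s)
open import Data.Nat.DivMod using (m≡m%n+[m/n]*n; m%n<n; %-distribˡ-*)
open import Data.Nat.GeneralisedArithmetic using (fold)
import Data.Nat.ListAction as ListAction
open import Data.Nat.Properties hiding (_≟_)
open import Data.Nat.Tactic.RingSolver using (solve-∀)
open import Data.Product using (Σ; ∃; _,_; _×_; proj₂; uncurry)
open import Data.Sum using (_⊎_; inj₁; inj₂)
open import Data.Vec using (tabulate; lookup)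
open import Data.Vec.Properties using (tabulate∘lookup; lookup∘tabulate; []=⇒lookup; lookup⇒[]=)
open import Function using (_∘_; id)
open import Function.Bundles using (Equivalence)
open import Relation.Binary.PropositionalEquality
open import Relation.Nullary using (¬_; Dec; contradiction; does; yes; no; ¬?; _×-dec_; _→-dec_)
open import Relation.Nullary.Decidable using (dec-true; T?)

open import Algebra.Properties.Semiring.Sum +-*-semiring
  using (sum; sum-syntax; ∑-distrib-+; ∑-comm; *-distribʳ-sum; sum-cong-≗; sum-replicate-zero)

am-gm : ∀ c d → 4 * (c * d) ≤ (c + d) * (c + d)
am-gm c d with ≤-total c d
... | inj₁ c≤d with m≤n⇒∃[o]m+o≡n c≤d
...   | o , refl = subst (4 * (c * (c + o)) ≤_) (square c o) (m≤m+n _ _)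
  where
  square : ∀ c o → 4 * (c * (c + o)) + o * o ≡ (c + (c + o)) * (c + (c + o))
  square = solve-∀
am-gm c d | inj₂ d≤c with m≤n⇒∃[o]m+o≡n d≤c
...   | o , refl = subst (4 * ((d + o) * d) ≤_) (square d o) (m≤m+n _ _)
  where
  square : ∀ d o → 4 * ((d + o) * d) + o * o ≡ (d + o + d) * (d + o + d)
  square = solve-∀

square%4≤1 : ∀ t → (t * t) % 4 ≤ 1
square%4≤1 t = subst (_≤ 1) (sym (%-distribˡ-* t t 4)) (residue (t % 4) (m%n<n t 4))
  where
  residue : ∀ r → r < 4 → (r * r) % 4 ≤ 1
  residue 0 _ = z≤n
  residue 1 _ = s≤s z≤n
  residue 2 _ = z≤n
  residue 3 _ = s≤s z≤n
  residue (suc (suc (suc (suc _)))) (s≤s (s≤s (s≤s (s≤s ()))))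

quarter-floor-bound : ∀ {δ t m} → δ * δ + t * t / 4 ≤ m → 4 * (δ * δ) + t * t ≤ 4 * m + 1
quarter-floor-bound {δ} {t} {m} dense = begin
  4 * (δ * δ) + t * t                   ≡⟨ cong (4 * (δ * δ) +_) (m≡m%n+[m/n]*n (t * t) 4) ⟩
  4 * (δ * δ) + ((t * t) % 4 + q * 4)   ≤⟨ +-monoʳ-≤ (4 * (δ * δ)) (+-monoˡ-≤ (q * 4) (square%4≤1 t)) ⟩
  4 * (δ * δ) + (1 + q * 4)             ≡⟨ regroup (δ * δ) q ⟩
  4 * (δ * δ + q) + 1                   ≤⟨ +-monoˡ-≤ 1 (*-monoʳ-≤ 4 dense) ⟩
  4 * m + 1                             ∎
  where
  open ≤-Reasoning
  q = t * t / 4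
  regroup : ∀ d q → 4 * d + (1 + q * 4) ≡ 4 * (d + q) + 1
  regroup = solve-∀

𝟙 : Bool → ℕ
𝟙 true  = 1
𝟙 false = 0

𝟙-mono : ∀ {a b} → (a ≡ true → b ≡ true) → 𝟙 a ≤ 𝟙 b
𝟙-mono {false} a⇒b = z≤n
𝟙-mono {true}  a⇒b rewrite a⇒b refl = ≤-refl

∑-mono-≤ : ∀ {n} {f g : Fin n → ℕ} → (∀ i → f i ≤ g i) → sum f ≤ sum g
∑-mono-≤ {zero}  f≤g = z≤n
∑-mono-≤ {suc n} f≤g = +-mono-≤ (f≤g zero) (∑-mono-≤ (f≤g ∘ suc))

∑-mono-< : ∀ {n} {f g : Fin n → ℕ} → (∀ i → f i ≤ g i) → ∀ i → f i < g i → sum f < sum g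
∑-mono-< f≤g zero    f<g = +-mono-<-≤ f<g (∑-mono-≤ (f≤g ∘ suc))
∑-mono-< f≤g (suc i) f<g = +-mono-≤-< (f≤g zero) (∑-mono-< (f≤g ∘ suc) i f<g)

≤-∑ : ∀ {n} (f : Fin n → ℕ) i → f i ≤ sum f
≤-∑ f zero    = m≤m+n _ _
≤-∑ f (suc i) = ≤-trans (≤-∑ (f ∘ suc) i) (m≤n+m _ _)

∑∑-distrib-+ : ∀ {n} (f g : Fin n → Fin n → ℕ) →
  ∑[ u < n ] ∑[ v < n ] (f u v + g u v) ≡
  ∑[ u < n ] ∑[ v < n ] f u v + ∑[ u < n ] ∑[ v < n ] g u v
∑∑-distrib-+ f g =
  trans (sum-cong-≗ (λ u → ∑-distrib-+ (f u) (g u))) (∑-distrib-+ (λ u → sum (f u)) _)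

∑∑-symmetrise : ∀ {n} (h : Fin n → Fin n → ℕ) →
  ∑[ u < n ] ∑[ v < n ] (h u v + h v u) ≡ 2 * ∑[ u < n ] ∑[ v < n ] h u v
∑∑-symmetrise {n} h = begin
  ∑[ u < n ] ∑[ v < n ] (h u v + h v u)                       ≡⟨ ∑∑-distrib-+ h (λ u v → h v u) ⟩
  ∑[ u < n ] ∑[ v < n ] h u v + ∑[ u < n ] ∑[ v < n ] h v u   ≡⟨ cong (s +_) (∑-comm h) ⟨
  s + s                                                       ≡⟨ cong (s +_) (+-identityʳ s) ⟨
  2 * s                                                       ∎
  where
  open ≡-Reasoning
  s = ∑[ u < n ] ∑[ v < n ] h u v

infix 4 _⊆_

_⊆_ : ∀ {n} (P Q : Fin n → Bool) → Set
P ⊆ Q = ∀ {i} → P i ≡ true → Q i ≡ true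

count : ∀ {n} → (Fin n → Bool) → ℕ
count {n} P = ∑[ i < n ] 𝟙 (P i)

private
  variable
    n : ℕ
    P Q : Fin n → Bool

count-cong : (∀ i → P i ≡ Q i) → count P ≡ count Q
count-cong P≗Q = sum-cong-≗ (cong 𝟙 ∘ P≗Q)

count-mono : P ⊆ Q → count P ≤ count Q
count-mono {P = P} {Q = Q} P⊆Q = ∑-mono-≤ {f = 𝟙 ∘ P} {g = 𝟙 ∘ Q} (λ _ → 𝟙-mono P⊆Q)

count-mono-< : P ⊆ Q → ∀ i → P i ≡ false → Q i ≡ true → count P < count Q
count-mono-< {P = P} {Q = Q} P⊆Q i Pi Qi =
  ∑-mono-< {f = 𝟙 ∘ P} {g = 𝟙 ∘ Q} (λ _ → 𝟙-mono P⊆Q) i 𝟙Pi<𝟙Qi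
  where
  𝟙Pi<𝟙Qi : 𝟙 (P i) < 𝟙 (Q i)
  𝟙Pi<𝟙Qi rewrite Pi | Qi = s≤s z≤n

⊇-by-count : P ⊆ Q → count Q ≤ count P → Q ⊆ P
⊇-by-count {P = P} P⊆Q Q≤P {i} Qi with P i in Pi
... | true  = refl
... | false = contradiction Q≤P (<⇒≱ (count-mono-< P⊆Q i Pi Qi))

count-all : ∀ n → count {n} (λ _ → true) ≡ n
count-all zero    = refl
count-all (suc n) = cong suc (count-all n)

count≤n : ∀ (P : Fin n → Bool) → count P ≤ n
count≤n {n} P = subst (count P ≤_) (count-all n) (count-mono {P = P} {Q = λ _ → true} (λ _ → refl))

count-pos : 0 < count P → ∃ λ i → P i ≡ true
count-pos {suc n} {P} pos with P zero in P0
... | true  = zero , P0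
... | false with count-pos {P = P ∘ suc} pos
...   | i , Pi = suc i , Pi

count-∧ˡ : ∀ b (P : Fin n → Bool) → count (λ i → b ∧ P i) ≡ 𝟙 b * count P
count-∧ˡ {n} false P = sum-replicate-zero n
count-∧ˡ     true  P = sym (+-identityʳ _)

count-split : ∀ (P Q : Fin n → Bool) →
  count (λ i → P i ∧ not (Q i)) + count (λ i → P i ∧ Q i) ≡ count P
count-split P Q = trans (sym (∑-distrib-+ (λ i → 𝟙 (P i ∧ not (Q i))) _)) (sum-cong-≗ split)
  where
  split : ∀ i → 𝟙 (P i ∧ not (Q i)) + 𝟙 (P i ∧ Q i) ≡ 𝟙 (P i)
  split i with P i | Q i
  ... | false | _     = refl
  ... | true  | false = refl
  ... | true  | true  = refl

count-∨-disjoint : (∀ i → P i ≡ true → Q i ≡ false) →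
  count (λ i → P i ∨ Q i) ≡ count P + count Q
count-∨-disjoint {P = P} {Q = Q} disjoint =
  trans (sum-cong-≗ (λ i → 𝟙-∨ (P i) (Q i) (disjoint i))) (∑-distrib-+ (𝟙 ∘ P) (𝟙 ∘ Q))
  where
  𝟙-∨ : ∀ a b → (a ≡ true → b ≡ false) → 𝟙 (a ∨ b) ≡ 𝟙 a + 𝟙 b
  𝟙-∨ true  b     a⇒¬b rewrite a⇒¬b refl = refl
  𝟙-∨ false true  _    = refl
  𝟙-∨ false false _    = refl

∑-𝟙*≤count* : ∀ (P : Fin n → Bool) (f : Fin n → ℕ) {M} → (∀ u → P u ≡ true → f u ≤ M) →
  ∑[ u < n ] (𝟙 (P u) * f u) ≤ count P * M
∑-𝟙*≤count* {n} P f {M} f≤M = begin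
  ∑[ u < n ] (𝟙 (P u) * f u) ≤⟨ ∑-mono-≤ bounded ⟩
  ∑[ u < n ] (𝟙 (P u) * M)   ≡⟨ *-distribʳ-sum M (𝟙 ∘ P) ⟨
  count P * M                ∎
  where
  open ≤-Reasoning
  bounded : ∀ u → 𝟙 (P u) * f u ≤ 𝟙 (P u) * M
  bounded u with P u in Pu
  ... | false = z≤n
  ... | true  = *-monoʳ-≤ 1 (f≤M u Pu)

∣tabulate∣≡count : ∀ (P : Fin n → Bool) → ∣ tabulate P ∣ ≡ count P
∣tabulate∣≡count {zero}  P = refl
∣tabulate∣≡count {suc n} P with P zero
... | true  = cong suc (∣tabulate∣≡count (P ∘ suc))
... | false = ∣tabulate∣≡count (P ∘ suc)

∣∣≡count : ∀ (S : Subset n) → ∣ S ∣ ≡ count (lookup S)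
∣∣≡count S = trans (cong ∣_∣ (sym (tabulate∘lookup S))) (∣tabulate∣≡count (lookup S))

sum-allFin : ∀ (f : Fin n → ℕ) → ListAction.sum (List.map f (List.allFin n)) ≡ ∑[ i < n ] f i
sum-allFin f = trans (cong ListAction.sum (map-tabulate id f)) (sum-tabulate f)
  where
  sum-tabulate : ∀ {n} (g : Fin n → ℕ) → ListAction.sum (List.tabulate g) ≡ ∑[ i < n ] g i
  sum-tabulate {zero}  g = refl
  sum-tabulate {suc n} g = cong (g zero +_) (sum-tabulate (g ∘ suc))

second-element : ∀ (P : Fin n → Bool) w → 2 ≤ count P → ∃ λ i → i ≢ w × P i ≡ true
second-element P w two with any? (λ i → ¬? (i ≟ w) ×-dec P i Bool.≟ true)
... | yes found = found
... | no  none  = contradiction (≤-trans two (count-mono {P = P} only-w)) (<⇒≱ singleton)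
  where
  only-w : P ⊆ lookup ⁅ w ⁆
  only-w {i} Pi with i ≟ w
  ... | yes refl = []=⇒lookup (x∈⁅x⁆ w)
  ... | no  i≢w  = contradiction (i , i≢w , Pi) none
  singleton : count (lookup ⁅ w ⁆) < 2
  singleton = s≤s (≤-reflexive (trans (sym (∣∣≡count ⁅ w ⁆)) (∣⁅x⁆∣≡1 w)))

max-attained : ∀ (f : Fin (suc n) → ℕ) → ∃ λ x → ∀ y → f y ≤ f x
max-attained {n} f = argmax f zero (List.allFin (suc n)) ,
  λ y → All.lookup (f[xs]≤f[argmax] {f = f} zero (List.allFin (suc n))) (∈-allFin y)
  where open Extrema ≤-totalOrder

any : (Fin n → Bool) → Bool
any P = does (any? (T? ∘ P))

any-intro : ∀ (P : Fin n → Bool) {i} → P i ≡ true → any P ≡ true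
any-intro P {i} Pi = dec-true (any? (T? ∘ P)) (i , Equivalence.from T-≡ Pi)

any-elim : ∀ (P : Fin n → Bool) → any P ≡ true → ∃ λ i → P i ≡ true
any-elim P found with any? (T? ∘ P)
... | yes (i , Pi) = i , Equivalence.to T-≡ Pi

not-true : ∀ {b} → not b ≡ true → b ≡ false
not-true {b} nb = trans (sym (not-involutive b)) (cong not nb)

∨-by-cases : ∀ a b → (b ≡ false → a ≡ true) → a ∨ b ≡ true
∨-by-cases a     true  _   = ∨-zeroʳ a
∨-by-cases true  false _   = refl
∨-by-cases false false a⇐b = a⇐b refl

not≡not∨∨ : ∀ a b → (a ≡ true → b ≡ false) → not a ≡ not (a ∨ b) ∨ b
not≡not∨∨ true  b     a⇒¬b rewrite a⇒¬b refl = refl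
not≡not∨∨ false true  _    = refl
not≡not∨∨ false false _    = refl

-- Counting edges

𝟙-orientations : ∀ (u v : Fin n) b → (u ≡ v → b ≡ false) →
  𝟙 ((toℕ u <ᵇ toℕ v) ∧ b) + 𝟙 ((toℕ v <ᵇ toℕ u) ∧ b) ≡ 𝟙 b
𝟙-orientations u v b loopless with toℕ u <ᵇ toℕ v in u<v | toℕ v <ᵇ toℕ u in v<u
... | true  | true  = contradiction (<ᵇ⇒< (toℕ u) (toℕ v) (subst T (sym u<v) _))
                                   (<-asym (<ᵇ⇒< (toℕ v) (toℕ u) (subst T (sym v<u) _)))
... | true  | false = +-identityʳ (𝟙 b)
... | false | true  = refl
... | false | false rewrite loopless (toℕ-injective (≤-antisym (≮⇒≥ (subst T v<u ∘ <⇒<ᵇ))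
                                                                (≮⇒≥ (subst T u<v ∘ <⇒<ᵇ)))) = refl

module _ {n} (G : Graph n) where

  deg : Fin n → ℕ
  deg u = count (adj G u)

  degree≡deg : ∀ u → degree G u ≡ deg u
  degree≡deg u = ∣tabulate∣≡count (adj G u)

  -- Ordered pairs, so that arcs (λ _ → true) is twice the number of edges.
  arcs : (Fin n → Bool) → ℕ
  arcs B = ∑[ u < n ] ∑[ v < n ] 𝟙 ((B u ∧ B v) ∧ adj G u v)

  handshake : 2 * size G ≡ arcs (λ _ → true)
  handshake = begin
    2 * size G
      ≡⟨ cong (2 *_) size≡ ⟩
    2 * ∑[ u < n ] ∑[ v < n ] 𝟙 (forward u v)
      ≡⟨ ∑∑-symmetrise (λ u v → 𝟙 (forward u v)) ⟨
    ∑[ u < n ] ∑[ v < n ] (𝟙 (forward u v) + 𝟙 (forward v u))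
      ≡⟨ sum-cong-≗ (sum-cong-≗ ∘ both-ways) ⟩
    arcs (λ _ → true)                                          ∎
    where
    open ≡-Reasoning
    forward : Fin n → Fin n → Bool
    forward u v = (toℕ u <ᵇ toℕ v) ∧ adj G u v
    size≡ : size G ≡ ∑[ u < n ] ∑[ v < n ] 𝟙 (forward u v)
    size≡ = trans (sum-allFin (λ u → ∣ tabulate (forward u) ∣))
                  (sum-cong-≗ (∣tabulate∣≡count ∘ forward))
    both-ways : ∀ u v → 𝟙 (forward u v) + 𝟙 (forward v u) ≡ 𝟙 (adj G u v)
    both-ways u v rewrite Graph.sym G v u = 𝟙-orientations u v (adj G u v) (λ { refl → irrfl G u })

  arcs-cover : ∀ {P Q} → (∀ u v → Adj G u v → (P u ∧ P v) ≡ true ⊎ (Q u ∧ Q v) ≡ true) →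
    arcs (λ _ → true) ≤ arcs P + arcs Q
  arcs-cover {P} {Q} covered = begin
    arcs (λ _ → true)
      ≤⟨ ∑-mono-≤ (λ u → ∑-mono-≤ (inside u)) ⟩
    ∑[ u < n ] ∑[ v < n ] (𝟙 ((P u ∧ P v) ∧ adj G u v) + 𝟙 ((Q u ∧ Q v) ∧ adj G u v))
      ≡⟨ ∑∑-distrib-+ (λ u v → 𝟙 ((P u ∧ P v) ∧ adj G u v)) _ ⟩
    arcs P + arcs Q ∎
    where
    open ≤-Reasoning
    inside : ∀ u v → 𝟙 (adj G u v) ≤ 𝟙 ((P u ∧ P v) ∧ adj G u v) + 𝟙 ((Q u ∧ Q v) ∧ adj G u v)
    inside u v with adj G u v in uv
    ... | false = z≤n
    ... | true with covered u v uv
    ...   | inj₁ inP rewrite inP = s≤s z≤n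
    ...   | inj₂ inQ rewrite inQ = m≤n+m 1 _

  NoIsolated : (Fin n → Bool) → Set
  NoIsolated Z = ∀ x → Z x ≡ true → ∃ λ x′ → Z x′ ≡ true × Adj G x x′

  count≤arcs : ∀ {Z} → NoIsolated Z → count Z ≤ arcs Z
  count≤arcs {Z} no-isolated = ∑-mono-≤ has-arc
    where
    has-arc : ∀ u → 𝟙 (Z u) ≤ ∑[ v < n ] 𝟙 ((Z u ∧ Z v) ∧ adj G u v)
    has-arc u with Z u in Zu
    ... | false = z≤n
    ... | true with no-isolated u Zu
    ...   | x′ , Zx′ , ux′ = ≤-trans (≤-reflexive (cong₂ (λ b c → 𝟙 (b ∧ c)) (sym Zx′) (sym ux′)))
                                     (≤-∑ (λ v → 𝟙 (Z v ∧ adj G u v)) x′)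

  -- Every arc has both ends in W or is counted by the degree sum over Z, twice if both ends are in Z.
  arcs-split : ∀ {Z W} → (∀ u → Z u ∨ W u ≡ true) →
    arcs (λ _ → true) + arcs Z ≤ arcs W + 2 * ∑[ u < n ] (𝟙 (Z u) * deg u)
  arcs-split {Z} {W} Z∪W = begin
    arcs (λ _ → true) + arcs Z
      ≡⟨ ∑∑-distrib-+ (λ u v → 𝟙 (adj G u v)) _ ⟨
    ∑[ u < n ] ∑[ v < n ] (𝟙 (adj G u v) + 𝟙 ((Z u ∧ Z v) ∧ adj G u v))
      ≤⟨ ∑-mono-≤ (λ u → ∑-mono-≤ (split u)) ⟩
    ∑[ u < n ] ∑[ v < n ] (𝟙 ((W u ∧ W v) ∧ adj G u v) + (h u v + h v u))
      ≡⟨ ∑∑-distrib-+ (λ u v → 𝟙 ((W u ∧ W v) ∧ adj G u v)) _ ⟩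
    arcs W + ∑[ u < n ] ∑[ v < n ] (h u v + h v u)
      ≡⟨ cong (arcs W +_) (∑∑-symmetrise h) ⟩
    arcs W + 2 * ∑[ u < n ] ∑[ v < n ] h u v
      ≡⟨ cong (λ s → arcs W + 2 * s) (sum-cong-≗ (λ u → count-∧ˡ (Z u) (adj G u))) ⟩
    arcs W + 2 * ∑[ u < n ] (𝟙 (Z u) * deg u) ∎
    where
    open ≤-Reasoning
    h : Fin n → Fin n → ℕ
    h u v = 𝟙 (Z u ∧ adj G u v)
    in-W : ∀ u → Z u ≡ false → W u ≡ true
    in-W u Zu = subst (λ b → b ∨ W u ≡ true) Zu (Z∪W u)
    split : ∀ u v → 𝟙 (adj G u v) + 𝟙 ((Z u ∧ Z v) ∧ adj G u v) ≤
                    𝟙 ((W u ∧ W v) ∧ adj G u v) + (h u v + h v u)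
    split u v rewrite Graph.sym G v u with Z u in Zu | Z v in Zv | adj G u v
    ... | true  | true  | true  = m≤n+m 2 _
    ... | true  | false | true  = m≤n+m 1 _
    ... | false | true  | true  = m≤n+m 1 _
    ... | false | false | true rewrite in-W u Zu | in-W v Zv = ≤-refl
    ... | true  | true  | false = z≤n
    ... | true  | false | false = z≤n
    ... | false | true  | false = z≤n
    ... | false | false | false = z≤n

module _ {n} (G : Graph n) (triangle-free : TriangleFree G) (B : Fin n → Bool) where

  private
    dB : Fin n → ℕ
    dB u = count (λ v → B v ∧ adj G u v)

  -- Since G is triangle-free, every arc of B has an end outside the neighbourhood of x.
  mantel-from-max : ∀ x → (∀ u → dB u ≤ dB x) → 2 * arcs G B ≤ count B * count B
  mantel-from-max x maximal = begin
    2 * arcs G B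
      ≤⟨ *-monoʳ-≤ 2 (∑-mono-≤ (λ u → ∑-mono-≤ {g = λ v → h u v + h v u} (split u))) ⟩
    2 * ∑[ u < n ] ∑[ v < n ] (h u v + h v u)
      ≡⟨ cong (2 *_) (∑∑-symmetrise h) ⟩
    2 * (2 * ∑[ u < n ] ∑[ v < n ] h u v)
      ≡⟨ cong (λ s → 2 * (2 * s)) (sum-cong-≗ (λ u → count-∧ˡ (far u) (λ v → B v ∧ adj G u v))) ⟩
    2 * (2 * ∑[ u < n ] (𝟙 (far u) * dB u))
      ≤⟨ *-monoʳ-≤ 2 (*-monoʳ-≤ 2 (∑-𝟙*≤count* far dB (λ u _ → maximal u))) ⟩
    2 * (2 * (count far * dB x))
      ≡⟨ *-assoc 2 2 (count far * dB x) ⟨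
    4 * (count far * dB x)
      ≤⟨ am-gm (count far) (dB x) ⟩
    (count far + dB x) * (count far + dB x)
      ≡⟨ cong (λ c → c * c) (count-split B (adj G x)) ⟩
    count B * count B                           ∎
    where
    open ≤-Reasoning
    far : Fin n → Bool
    far u = B u ∧ not (adj G x u)
    h : Fin n → Fin n → ℕ
    h u v = 𝟙 (far u ∧ (B v ∧ adj G u v))
    split : ∀ u v → 𝟙 ((B u ∧ B v) ∧ adj G u v) ≤ h u v + h v u
    split u v rewrite Graph.sym G v u
      with B u | B v | adj G u v in uv | adj G x u in xu | adj G x v in xv
    ... | false | _     | _     | _     | _     = z≤n
    ... | true  | false | _     | _     | _     = z≤n
    ... | true  | true  | false | _     | _     = z≤n
    ... | true  | true  | true  | false | _     = s≤s z≤n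
    ... | true  | true  | true  | true  | false = s≤s z≤n
    ... | true  | true  | true  | true  | true  = ⊥-elim (triangle-free x u v xu uv xv)

mantel : ∀ (G : Graph n) → TriangleFree G → ∀ B → 2 * arcs G B ≤ count B * count B
mantel {zero}  G triangle-free B = z≤n
mantel {suc n} G triangle-free B =
  uncurry (mantel-from-max G triangle-free B) (max-attained (λ u → count (λ v → B v ∧ adj G u v)))

module _ {n} (G : Graph n) (triangle-free : TriangleFree G) where

  disjoint-neighbourhoods : ∀ {x x′ R} → Adj G x x′ → adj G x ⊆ R → adj G x′ ⊆ R →
    deg G x + deg G x′ ≤ count R
  disjoint-neighbourhoods {x} {x′} {R} xx′ Nx⊆R Nx′⊆R = begin
    deg G x + deg G x′                             ≡⟨ ∑-distrib-+ (𝟙 ∘ adj G x) (𝟙 ∘ adj G x′) ⟨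
    ∑[ z < n ] (𝟙 (adj G x z) + 𝟙 (adj G x′ z))    ≤⟨ ∑-mono-≤ disjoint ⟩
    count R                                        ∎
    where
    open ≤-Reasoning
    disjoint : ∀ z → 𝟙 (adj G x z) + 𝟙 (adj G x′ z) ≤ 𝟙 (R z)
    disjoint z with adj G x z in xz | adj G x′ z in x′z
    ... | true  | true  = ⊥-elim (triangle-free x x′ z xx′ x′z xz)
    ... | true  | false rewrite Nx⊆R xz = ≤-refl
    ... | false | true  rewrite Nx′⊆R x′z = ≤-refl
    ... | false | false = z≤n

  module _ {δ} (δ≤deg : ∀ x → δ ≤ deg G x) {Z R} (no-isolated : NoIsolated G Z)
           (Z-closed : ∀ x → Z x ≡ true → adj G x ⊆ R) where

    neighbour-bound : ∀ x → Z x ≡ true → deg G x + δ ≤ count R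
    neighbour-bound x Zx with no-isolated x Zx
    ... | x′ , Zx′ , xx′ = ≤-trans (+-monoʳ-≤ (deg G x) (δ≤deg x′))
                                   (disjoint-neighbourhoods xx′ (Z-closed x Zx) (Z-closed x′ Zx′))

    degree-sum-bound : ∑[ u < n ] (𝟙 (Z u) * deg G u) + count Z * δ ≤ count Z * count R
    degree-sum-bound = begin
      ∑[ u < n ] (𝟙 (Z u) * deg G u) + count Z * δ
        ≡⟨ cong (∑[ u < n ] (𝟙 (Z u) * deg G u) +_) (*-distribʳ-sum δ (𝟙 ∘ Z)) ⟩
      ∑[ u < n ] (𝟙 (Z u) * deg G u) + ∑[ u < n ] (𝟙 (Z u) * δ)
        ≡⟨ ∑-distrib-+ (λ u → 𝟙 (Z u) * deg G u) _ ⟨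
      ∑[ u < n ] (𝟙 (Z u) * deg G u + 𝟙 (Z u) * δ)
        ≡⟨ sum-cong-≗ (λ u → *-distribˡ-+ (𝟙 (Z u)) (deg G u) δ) ⟨
      ∑[ u < n ] (𝟙 (Z u) * (deg G u + δ))
        ≤⟨ ∑-𝟙*≤count* Z (λ u → deg G u + δ) neighbour-bound ⟩
      count Z * count R ∎
      where open ≤-Reasoning

    isolation-free-bound : ∀ {W} → (∀ u → Z u ∨ W u ≡ true) →
      2 * arcs G (λ _ → true) + 2 * count Z + 4 * (count Z * δ) ≤
      count W * count W + 4 * (count Z * count R)
    isolation-free-bound {W} Z∪W = begin
      2 * e + 2 * count Z + 4 * (count Z * δ)
        ≡⟨ regroup e (count Z) (count Z * δ) ⟩
      2 * (e + count Z) + 4 * (count Z * δ)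
        ≤⟨ +-monoˡ-≤ _ (*-monoʳ-≤ 2 (+-monoʳ-≤ e (count≤arcs G no-isolated))) ⟩
      2 * (e + arcs G Z) + 4 * (count Z * δ)
        ≤⟨ +-monoˡ-≤ _ (*-monoʳ-≤ 2 (arcs-split G {Z} {W} Z∪W)) ⟩
      2 * (arcs G W + 2 * D) + 4 * (count Z * δ)
        ≡⟨ regroup′ (arcs G W) D (count Z * δ) ⟩
      2 * arcs G W + 4 * (D + count Z * δ)
        ≤⟨ +-mono-≤ (mantel G triangle-free W) (*-monoʳ-≤ 4 degree-sum-bound) ⟩
      count W * count W + 4 * (count Z * count R)   ∎
      where
      open ≤-Reasoning
      e = arcs G (λ _ → true)
      D = ∑[ u < n ] (𝟙 (Z u) * deg G u)
      regroup : ∀ e c d → 2 * e + 2 * c + 4 * d ≡ 2 * (e + c) + 4 * d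
      regroup = solve-∀
      regroup′ : ∀ w D d → 2 * (w + 2 * D) + 4 * d ≡ 2 * w + 4 * (D + d)
      regroup′ = solve-∀

-- Components

module Saturation {n} (step : (Fin n → Bool) → Fin n → Bool)
  (extensive : ∀ P → P ⊆ step P) (monotone : ∀ {P Q} → P ⊆ Q → step P ⊆ step Q)
  (P₀ : Fin n → Bool) where

  stage : ℕ → Fin n → Bool
  stage = fold P₀ step

  stable-or-large : ∀ k → step (stage k) ⊆ stage k ⊎ k ≤ count (stage k)
  stable-or-large zero = inj₂ z≤n
  stable-or-large (suc k) with stable-or-large k
  ... | inj₁ stable = inj₁ (monotone stable)
  ... | inj₂ large with count (stage (suc k)) ≤? count (stage k)
  ...   | yes no-growth =
    inj₁ (monotone (⊇-by-count {P = stage k} {Q = stage (suc k)} (extensive (stage k)) no-growth))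
  ...   | no  growth    = inj₂ (≤-trans (s≤s large) (≰⇒> growth))

  saturation : Fin n → Bool
  saturation = stage (suc n)

  saturation-closed : step saturation ⊆ saturation
  saturation-closed with stable-or-large (suc n)
  ... | inj₁ stable = stable
  ... | inj₂ large  = contradiction (count≤n saturation) (<⇒≱ large)

  saturation-⊇ : P₀ ⊆ saturation
  saturation-⊇ = go (suc n)
    where
    go : ∀ k → P₀ ⊆ stage k
    go zero    = id
    go (suc k) = extensive (stage k) ∘ go k

  saturation-induction : ∀ (I : Fin n → Set) → (∀ {i} → P₀ i ≡ true → I i) →
    (∀ P → (∀ {i} → P i ≡ true → I i) → ∀ {i} → step P i ≡ true → I i) →
    ∀ {i} → saturation i ≡ true → I i
  saturation-induction I base closed = go (suc n)
    where
    go : ∀ k {i} → stage k i ≡ true → I i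
    go zero    = base
    go (suc k) = closed (stage k) (go k)

module _ {n} {G : Graph n} {S : Subset n} where

  reach-start : ∀ {x y} → Reach G S x y → x ∉ S
  reach-start (here x∉S)     = x∉S
  reach-start (step x∉S _ _) = x∉S

  reach-end : ∀ {x y} → Reach G S x y → y ∉ S
  reach-end (here y∉S)   = y∉S
  reach-end (step _ _ r) = reach-end r

  reach-snoc : ∀ {x y z} → Reach G S x y → Adj G y z → z ∉ S → Reach G S x z
  reach-snoc (here x∉S)       yz z∉S = step x∉S yz (here z∉S)
  reach-snoc (step x∉S xw r) yz z∉S = step x∉S xw (reach-snoc r yz z∉S)

∉⇒lookup≡false : ∀ {S : Subset n} {x} → x ∉ S → lookup S x ≡ false
∉⇒lookup≡false {S = S} {x} x∉S with lookup S x in Sx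
... | false = refl
... | true  = contradiction (lookup⇒[]= x S Sx) x∉S

lookup≡false⇒∉ : ∀ {S : Subset n} {x} → lookup S x ≡ false → x ∉ S
lookup≡false⇒∉ Sx x∈S with trans (sym ([]=⇒lookup x∈S)) Sx
... | ()

module Component {n} (G : Graph n) (S : Subset n) (u : Fin n) (u∉S : u ∉ S) where

  grow : (Fin n → Bool) → Fin n → Bool
  grow P y = P y ∨ (not (lookup S y) ∧ any (λ x → P x ∧ adj G x y))

  private
    grow-extensive : ∀ P → P ⊆ grow P
    grow-extensive P {y} Py = cong (_∨ (not (lookup S y) ∧ any (λ x → P x ∧ adj G x y))) Py

    grow-cases : ∀ P {y} → grow P y ≡ true →
      P y ≡ true ⊎ (lookup S y ≡ false × ∃ λ x → P x ≡ true × Adj G x y)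
    grow-cases P {y} grown with P y
    ... | true  = inj₁ refl
    ... | false with any-elim _ (∧-conicalʳ _ _ grown)
    ...   | x , Px∧xy =
      inj₂ (not-true (∧-conicalˡ _ _ grown) , x , ∧-conicalˡ _ _ Px∧xy , ∧-conicalʳ _ _ Px∧xy)

    grows-into : ∀ P {x y} → P x ≡ true → Adj G x y → lookup S y ≡ false → grow P y ≡ true
    grows-into P {x} {y} Px xy Sy rewrite Sy =
      trans (cong (P y ∨_) (any-intro (λ x → P x ∧ adj G x y) (cong₂ _∧_ Px xy))) (∨-zeroʳ (P y))

    grow-monotone : ∀ {P Q} → P ⊆ Q → grow P ⊆ grow Q
    grow-monotone {P} {Q} P⊆Q grown with grow-cases P grown
    ... | inj₁ Py                 = grow-extensive Q (P⊆Q Py)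
    ... | inj₂ (Sy , x , Px , xy) = grows-into Q (P⊆Q Px) xy Sy

  open Saturation grow grow-extensive grow-monotone (λ y → does (y ≟ u))

  component : Fin n → Bool
  component = saturation

  u∈component : component u ≡ true
  u∈component = saturation-⊇ (dec-true (u ≟ u) refl)

  component-reachable : ∀ {y} → component y ≡ true → Reach G S u y
  component-reachable = saturation-induction (Reach G S u) from-u reach-grown
    where
    from-u : ∀ {y} → does (y ≟ u) ≡ true → Reach G S u y
    from-u {y} is-u with y ≟ u
    ... | yes refl = here u∉S
    reach-grown : ∀ P → (∀ {i} → P i ≡ true → Reach G S u i) →
                  ∀ {y} → grow P y ≡ true → Reach G S u y
    reach-grown P reach grown with grow-cases P grown
    ... | inj₁ Py                 = reach Py
    ... | inj₂ (Sy , x , Px , xy) = reach-snoc (reach Px) xy (lookup≡false⇒∉ Sy)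

  component-closed : ∀ {x y} → component x ≡ true → Adj G x y → lookup S y ≡ false →
                     component y ≡ true
  component-closed Cx xy Sy = saturation-closed (grows-into component Cx xy Sy)

module _ {n} (G : Graph n) (triangle-free : TriangleFree G) where

  private
    N : Fin n → Subset n
    N w = tabulate (adj G w)

    N-lookup : ∀ w x → lookup (N w) x ≡ adj G w x
    N-lookup w = lookup∘tabulate (adj G w)

  neighbourhood-cut : (∀ x → 2 ≤ deg G x) → ∀ w → IsVertexCut G (N w)
  neighbourhood-cut 2≤deg w with count-pos {P = adj G w} (≤-trans (s≤s z≤n) (2≤deg w))
  ... | x , wx with second-element (adj G x) w (2≤deg x)
  ...   | y , y≢w , xy = w , y , lookup≡false⇒∉ (trans (N-lookup w w) (irrfl G w)) ,
                         lookup≡false⇒∉ (trans (N-lookup w y) w≁y) , no-walk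
    where
    w≁y : adj G w y ≡ false
    w≁y with adj G w y in wy
    ... | false = refl
    ... | true  = ⊥-elim (triangle-free w x y wx xy wy)
    no-walk : ¬ Reach G (N w) w y
    no-walk (here _)      = y≢w refl
    no-walk (step _ wz r) = reach-start r (lookup⇒[]= _ (N w) (trans (N-lookup w _) wz))

trapped-degree : ∀ (G : Graph n) {S y} → (∀ z → Adj G y z → z ∈ S) → degree G y ≤ ∣ S ∣
trapped-degree G {S} {y} N⊆S = begin
  degree G y         ≡⟨ degree≡deg G y ⟩
  count (adj G y)    ≤⟨ count-mono {P = adj G y} (λ {z} yz → []=⇒lookup (N⊆S z yz)) ⟩
  count (lookup S)   ≡⟨ ∣∣≡count S ⟨
  ∣ S ∣              ∎
  where open ≤-Reasoning

module _ {n} (G : Graph n) (S : Subset n) where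

  private
    trapped? : ∀ y z → Dec (Adj G y z → z ∈ S)
    trapped? y z = adj G y z Bool.≟ true →-dec z ∈? S

  isolated-or-escaping :
    (∃ λ y → y ∉ S × ∀ z → Adj G y z → z ∈ S) ⊎
    (∀ y → lookup S y ≡ false → ∃ λ z → Adj G y z × lookup S z ≡ false)
  isolated-or-escaping with any? (λ y → ¬? (y ∈? S) ×-dec all? (trapped? y))
  ... | yes isolated = inj₁ isolated
  ... | no  none     = inj₂ escape
    where
    escape : ∀ y → lookup S y ≡ false → ∃ λ z → Adj G y z × lookup S z ≡ false
    escape y Sy with ¬∀⟶∃¬ n _ (trapped? y) (λ trapped → none (y , lookup≡false⇒∉ Sy , trapped))
    ... | z , ¬trapped with adj G y z Bool.≟ true
    ...   | yes yz  = z , yz , ∉⇒lookup≡false (λ z∈S → ¬trapped (λ _ → z∈S))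
    ...   | no  y≁z = contradiction (λ yz → contradiction yz y≁z) ¬trapped

-- The numerical contradiction

tight-side-impossible : ∀ δ q e → 1 ≤ δ →
  2 * e + 2 * δ + 4 * (δ * δ) ≤ q * q + 4 * (δ * (δ + δ)) →
  4 * (δ * δ) + q * q ≤ 2 * e + 1 → ⊥
tight-side-impossible δ q e 1≤δ side dense = <⇒≱ (*-monoʳ-≤ 2 1≤δ) (+-cancelˡ-≤ s (2 * δ) 1 (begin
  s + 2 * δ                                               ≡⟨ regroup δ q e ⟩
  (2 * e + 2 * δ + 4 * (δ * δ)) + (4 * (δ * δ) + q * q)   ≤⟨ +-mono-≤ side dense ⟩
  (q * q + 4 * (δ * (δ + δ))) + (2 * e + 1)               ≡⟨ regroup′ δ q e ⟩
  s + 1                                                   ∎))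
  where
  open ≤-Reasoning
  s = 2 * e + q * q + 8 * (δ * δ)
  regroup : ∀ δ q e → 2 * e + q * q + 8 * (δ * δ) + 2 * δ ≡
    (2 * e + 2 * δ + 4 * (δ * δ)) + (4 * (δ * δ) + q * q)
  regroup = solve-∀
  regroup′ : ∀ δ q e → (q * q + 4 * (δ * (δ + δ))) + (2 * e + 1) ≡
    2 * e + q * q + 8 * (δ * δ) + 1
  regroup′ = solve-∀

-- In excess≤1 and balanced-cut-impossible, δ = |S| + z, |X| = δ + z + x, |Y| = δ + z + y and
-- n − δ = 2δ + x + y + z, written with z, x, y leftmost so that setting them to 0 reduces.

excess≤1 : ∀ k z x y e →
  let δ = z + k; a = x + (z + δ); b = y + (z + δ); t = z + (x + (y + δ + δ)) in
  2 * e ≤ (a + k) * (a + k) + (b + k) * (b + k) →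
  4 * (δ * δ) + t * t ≤ 2 * e + 1 →
  4 * (δ * z) + 2 * (x * y) ≤ 1
excess≤1 k z x y e parts dense = ≤-trans (m≤m+n _ _) (+-cancelˡ-≤ _ _ 1 (begin
  s + (4 * (δ * z) + 2 * (x * y) + r)  ≡⟨ expand k z x y ⟨
  4 * (δ * δ) + t * t                  ≤⟨ dense ⟩
  2 * e + 1                            ≤⟨ +-monoˡ-≤ 1 parts ⟩
  s + 1                                ∎))
  where
  open ≤-Reasoning
  δ = z + k
  a = x + (z + δ)
  b = y + (z + δ)
  t = z + (x + (y + δ + δ))
  s = (a + k) * (a + k) + (b + k) * (b + k)
  r = 2 * (x * z) + 2 * (y * z) + z * z
  expand : ∀ k z x y →
    let δ = z + k; a = x + (z + δ); b = y + (z + δ); t = z + (x + (y + δ + δ)) in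
    4 * (δ * δ) + t * t ≡
    (a + k) * (a + k) + (b + k) * (b + k) + (4 * (δ * z) + 2 * (x * y) + (2 * (x * z) + 2 * (y * z) + z * z))
  expand = solve-∀

balanced-cut-impossible : ∀ k z x y e →
  let δ = z + k; a = x + (z + δ); b = y + (z + δ); t = z + (x + (y + δ + δ)) in
  2 ≤ δ →
  2 * e ≤ (a + k) * (a + k) + (b + k) * (b + k) →
  2 * e + 2 * a + 4 * (a * δ) ≤ (b + k) * (b + k) + 4 * (a * (a + k)) →
  2 * e + 2 * b + 4 * (b * δ) ≤ (a + k) * (a + k) + 4 * (b * (b + k)) →
  4 * (δ * δ) + t * t ≤ 2 * e + 1 → ⊥
balanced-cut-impossible k (suc z) x y e 2≤δ parts _ _ dense =
  <⇒≱ (≤-trans 2≤δ (≤-trans (m≤m*n (suc z + k) (suc z)) (m≤n*m _ 4)))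
      (≤-trans (m≤m+n _ _) (excess≤1 k (suc z) x y e parts dense))
balanced-cut-impossible k zero (suc x) (suc y) e _ parts _ _ dense =
  <⇒≱ (*-monoʳ-≤ 2 (s≤s z≤n))
      (≤-trans (m≤n+m _ _) (excess≤1 k zero (suc x) (suc y) e parts dense))
balanced-cut-impossible k zero zero y e 2≤δ _ sideˣ _ dense =
  tight-side-impossible k (y + k + k) e (≤-trans (s≤s z≤n) 2≤δ) sideˣ dense
balanced-cut-impossible k zero (suc x) zero e 2≤δ _ _ sideʸ dense =
  tight-side-impossible k (suc x + k + k) e (≤-trans (s≤s z≤n) 2≤δ) sideʸ
    (subst (λ t → 4 * (k * k) + t * t ≤ 2 * e + 1) (sym (+-assoc (suc x) k k)) dense)

private
  δ+δ≤a+k⇒δ+z≤a : ∀ {z k a} → (z + k) + (z + k) ≤ a + k → z + (z + k) ≤ a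
  δ+δ≤a+k⇒δ+z≤a {z} {k} {a} 2δ≤a+k = +-cancelʳ-≤ k _ _ (subst (_≤ a + k) (regroup z k) 2δ≤a+k)
    where
    regroup : ∀ z k → (z + k) + (z + k) ≡ z + (z + k) + k
    regroup = solve-∀

  a+b+k∸δ≡t : ∀ k z x y → let δ = z + k in
    x + (z + δ) + (y + (z + δ)) + k ∸ δ ≡ z + (x + (y + δ + δ))
  a+b+k∸δ≡t k z x y = trans (cong (_∸ (z + k)) (split k z x y)) (m+n∸m≡n (z + k) _)
    where
    split : ∀ k z x y → let δ = z + k in
      x + (z + δ) + (y + (z + δ)) + k ≡ δ + (z + (x + (y + δ + δ)))
    split = solve-∀

cut-arithmetic : ∀ {δ k a b p q n e} → p ≡ a + k → q ≡ b + k → n ≡ a + b + k →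
  2 ≤ δ → k ≤ δ → δ + δ ≤ p → δ + δ ≤ q →
  2 * e ≤ p * p + q * q →
  2 * e + 2 * a + 4 * (a * δ) ≤ q * q + 4 * (a * p) →
  2 * e + 2 * b + 4 * (b * δ) ≤ p * p + 4 * (b * q) →
  4 * (δ * δ) + (n ∸ δ) * (n ∸ δ) ≤ 2 * e + 1 → ⊥
cut-arithmetic {δ} {k} {a} {b} {e = e} refl refl refl 2≤δ k≤δ 2δ≤p 2δ≤q
  with δ ∸ k | m∸n+n≡m k≤δ
... | z | refl
  with a ∸ (z + (z + k)) | m∸n+n≡m {a} (δ+δ≤a+k⇒δ+z≤a {z} {k} {a} 2δ≤p)
     | b ∸ (z + (z + k)) | m∸n+n≡m {b} (δ+δ≤a+k⇒δ+z≤a {z} {k} {b} 2δ≤q)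
... | x | refl | y | refl = λ parts sideˣ sideʸ dense →
  balanced-cut-impossible k z x y e 2≤δ parts sideˣ sideʸ
    (subst (λ t → 4 * ((z + k) * (z + k)) + t * t ≤ 2 * e + 1) (a+b+k∸δ≡t k z x y) dense)

-- A cut without isolated vertices

module IsolationFreeCut {n} (G : Graph n) (triangle-free : TriangleFree G)
  {δ} (2≤δ : 2 ≤ δ) (δ≤deg : ∀ x → δ ≤ deg G x)
  (S : Subset n) {u v} (u∉S : u ∉ S) (v∉S : v ∉ S) (u↛v : ¬ Reach G S u v)
  (escapes : ∀ y → lookup S y ≡ false → ∃ λ z → Adj G y z × lookup S z ≡ false)
  where

  open Component G S u u∉S

  private
    s : Fin n → Bool
    s = lookup S

  X X∪S Y Y∪S : Fin n → Bool
  X       = component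
  X∪S y   = X y ∨ s y
  Y       = not ∘ X∪S
  Y∪S     = not ∘ X

  X∩S=∅ : ∀ {y} → X y ≡ true → s y ≡ false
  X∩S=∅ = ∉⇒lookup≡false ∘ reach-end ∘ component-reachable

  Y-parts : ∀ {y} → Y y ≡ true → X y ≡ false × s y ≡ false
  Y-parts Yy = ∨-conicalˡ _ _ (not-true Yy) , ∨-conicalʳ _ _ (not-true Yy)

  X-no-isolated : NoIsolated G X
  X-no-isolated x Xx with escapes x (X∩S=∅ Xx)
  ... | z , xz , sz = z , component-closed Xx xz sz , xz

  X-closed : ∀ x → X x ≡ true → adj G x ⊆ X∪S
  X-closed x Xx {z} xz = ∨-by-cases (X z) (s z) (component-closed Xx xz)

  Y-avoids-X : ∀ {y z} → Y y ≡ true → Adj G y z → X z ≡ false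
  Y-avoids-X {y} {z} Yy yz = ¬-not X-misses
    where
    X-misses : X z ≢ true
    X-misses Xz with Y-parts Yy
    ... | Xy , sy with trans (sym (component-closed Xz (trans (Graph.sym G z y) yz) sy)) Xy
    ... | ()

  Y-no-isolated : NoIsolated G Y
  Y-no-isolated y Yy with escapes y (proj₂ (Y-parts Yy))
  ... | z , yz , sz = z , cong not (cong₂ _∨_ (Y-avoids-X Yy yz) sz) , yz

  Y-closed : ∀ y → Y y ≡ true → adj G y ⊆ Y∪S
  Y-closed y Yy yz = cong not (Y-avoids-X Yy yz)

  v∈Y : Y v ≡ true
  v∈Y = cong not (cong₂ _∨_ (¬-not (u↛v ∘ component-reachable)) (∉⇒lookup≡false v∉S))

  edge-sides : ∀ a b → Adj G a b → (X∪S a ∧ X∪S b) ≡ true ⊎ (Y∪S a ∧ Y∪S b) ≡ true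
  edge-sides a b ab with X a Bool.≟ true | X b Bool.≟ true
  ... | yes Xa | _      = inj₁ (cong₂ _∧_ (cong (_∨ s a) Xa) (X-closed a Xa ab))
  ... | no  _  | yes Xb =
    inj₁ (cong₂ _∧_ (X-closed b Xb (trans (Graph.sym G b a) ab)) (cong (_∨ s b) Xb))
  ... | no  Xa | no  Xb = inj₂ (cong₂ _∧_ (cong not (¬-not Xa)) (cong not (¬-not Xb)))

  X∪S-size : count X∪S ≡ count X + count s
  X∪S-size = count-∨-disjoint {P = X} {Q = s} (λ _ → X∩S=∅)

  Y∪S-size : count Y∪S ≡ count Y + count s
  Y∪S-size = trans (count-cong (λ y → not≡not∨∨ (X y) (s y) X∩S=∅))
                   (count-∨-disjoint {P = Y} {Q = s} (λ _ → proj₂ ∘ Y-parts))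

  n-size : n ≡ count X + count Y + count s
  n-size = begin
    n                               ≡⟨ count-all n ⟨
    count {n} (λ _ → true)          ≡⟨ count-cong {Q = λ _ → true} (λ y → ∨-inverseʳ (X y)) ⟨
    count (λ y → X y ∨ Y∪S y)       ≡⟨ count-∨-disjoint {P = X} {Q = Y∪S} (λ _ → cong not) ⟩
    count X + count Y∪S             ≡⟨ cong (count X +_) Y∪S-size ⟩
    count X + (count Y + count s)   ≡⟨ +-assoc (count X) _ _ ⟨
    count X + count Y + count s     ∎
    where open ≡-Reasoning

  small-dense-cut-impossible : count s ≤ δ →
    4 * (δ * δ) + (n ∸ δ) * (n ∸ δ) ≤ 2 * arcs G (λ _ → true) + 1 → ⊥
  small-dense-cut-impossible k≤δ =
    cut-arithmetic {e = arcs G (λ _ → true)} X∪S-size Y∪S-size n-size 2≤δ k≤δ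
      (side-width X-no-isolated X-closed u∈component) (side-width Y-no-isolated Y-closed v∈Y)
      parts sideˣ sideʸ
    where
    side-width : ∀ {Z R x} → NoIsolated G Z → (∀ x → Z x ≡ true → adj G x ⊆ R) → Z x ≡ true →
      δ + δ ≤ count R
    side-width {x = x} no-isolated closed Zx =
      ≤-trans (+-monoˡ-≤ δ (δ≤deg x)) (neighbour-bound G triangle-free δ≤deg no-isolated closed x Zx)
    parts : 2 * arcs G (λ _ → true) ≤ count X∪S * count X∪S + count Y∪S * count Y∪S
    parts = ≤-trans (*-monoʳ-≤ 2 (arcs-cover G {X∪S} {Y∪S} edge-sides))
           (≤-trans (≤-reflexive (*-distribˡ-+ 2 (arcs G X∪S) (arcs G Y∪S)))
                    (+-mono-≤ (mantel G triangle-free X∪S) (mantel G triangle-free Y∪S)))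
    sideˣ : 2 * arcs G (λ _ → true) + 2 * count X + 4 * (count X * δ) ≤
            count Y∪S * count Y∪S + 4 * (count X * count X∪S)
    sideˣ = isolation-free-bound G triangle-free δ≤deg X-no-isolated X-closed (∨-inverseʳ ∘ X)
    sideʸ : 2 * arcs G (λ _ → true) + 2 * count Y + 4 * (count Y * δ) ≤
            count X∪S * count X∪S + 4 * (count Y * count Y∪S)
    sideʸ = isolation-free-bound G triangle-free δ≤deg Y-no-isolated Y-closed (∨-inverseˡ ∘ X∪S)

small-cut-isolates : ∀ (G : Graph n) → TriangleFree G → ∀ {δ} → 2 ≤ δ → (∀ x → δ ≤ deg G x) →
  4 * (δ * δ) + (n ∸ δ) * (n ∸ δ) ≤ 4 * size G + 1 →
  ∀ {S} → IsVertexCut G S → ∣ S ∣ ≤ δ →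
  Σ (Fin n) λ y → y ∉ S × (∀ z → Adj G y z → z ∈ S) × degree G y ≤ δ
small-cut-isolates {n} G triangle-free {δ} 2≤δ δ≤deg dense {S} (u , v , u∉S , v∉S , u↛v) |S|≤δ
  with isolated-or-escaping G S
... | inj₁ (y , y∉S , N⊆S) = y , y∉S , N⊆S , ≤-trans (trapped-degree G N⊆S) |S|≤δ
... | inj₂ escapes =
  ⊥-elim (small-dense-cut-impossible (subst (_≤ δ) (∣∣≡count S) |S|≤δ)
                                     (subst (λ e → 4 * (δ * δ) + (n ∸ δ) * (n ∸ δ) ≤ e + 1) 4m≡2e dense))
  where
  open IsolationFreeCut G triangle-free 2≤δ δ≤deg S u∉S v∉S u↛v escapes
  4m≡2e : 4 * size G ≡ 2 * arcs G (λ _ → true)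
  4m≡2e = trans (*-assoc 2 2 (size G)) (cong (2 *_) (handshake G))

theorem5p4 : (n : ℕ) (G : Graph n) (δ : ℕ) →
    Connected G → TriangleFree G → IsMinDegree G δ → 2 ≤ δ →
    δ * δ + ((n ∸ δ) * (n ∸ δ)) / 4 ≤ size G →
    SuperConnected G δ
theorem5p4 n G δ _ triangle-free (δ≤degree , w , degree-w≡δ) 2≤δ dense S (cut , minimum) =
  let y , y∉S , N⊆S , degree-y≤δ =
        small-cut-isolates G triangle-free 2≤δ δ≤deg (quarter-floor-bound {δ} {n ∸ δ} dense) cut |S|≤δ
  in  y , y∉S , N⊆S , ≤-antisym degree-y≤δ (δ≤degree y)
  where
  δ≤deg : ∀ x → δ ≤ deg G x
  δ≤deg x = subst (δ ≤_) (degree≡deg G x) (δ≤degree x)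
  |S|≤δ : ∣ S ∣ ≤ δ
  |S|≤δ = subst (∣ S ∣ ≤_) degree-w≡δ
                (minimum _ (neighbourhood-cut G triangle-free (≤-trans 2≤δ ∘ δ≤deg) w))
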